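{- Let $q$ be a prime power, $r^*=q^3-q$, $u^*=q^3+q^2$, $g^{(3)}=q^3-2q+1$, and for integers $r,s,t,u$ let $\Omega_{r,s,t,u}$ be as in the context. Then for every integer $t$ with $0\le t<q+1$, \[\#\Omega_{r^*,0,t,u^*}=1-g^{(3)}+r^*+(q-1)t+u^*.\]
   Context: $q$ is a power of a prime. For integers $r,s,t,u$, $\Omega_{r,s,t,u}=\{(i,j,k)\in\mathbb{Z}^3: -r\le i,\ -s\le i+(q^2+q)k<-s+(q^2+q),\ -t\le qi+(q^2+q)j+(q+1)k<-t+(q^2+q),\ -u\le -q^2i-(q^3-q)j-(q^3+q^2-q-1)k\}$. -}

module Defs where

open import Data.Nat as ℕ using (ℕ; suc)
open import Data.Nat.Primality using (Prime)
open import Data.Integer using (ℤ; +_; _+_; _-_; _*_; -_; _≤_; _<_)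
open import Data.Product using (Σ; ∃; _×_; _,_)
open import Data.List using (List; length)
open import Data.List.Membership.Propositional using (_∈_)
open import Data.List.Relation.Unary.Unique.Propositional using (Unique)
open import Function.Bundles using (_⇔_)

IsPrimePower : ℕ → Set
IsPrimePower q = ∃ λ p → ∃ λ k → Prime p × q ≡ p ℕ.^ suc k
  where open import Relation.Binary.PropositionalEquality using (_≡_)

Ω : (q : ℕ) (r s t u : ℤ) → ℤ × ℤ × ℤ → Set
Ω q r s t u (i , j , k) =
  (- r ≤ i)
  × (- s ≤ i + Q2Q * k) × (i + Q2Q * k < - s + Q2Q)
  × (- t ≤ Q * i + Q2Q * j + (Q + + 1) * k)
  × (Q * i + Q2Q * j + (Q + + 1) * k < - t + Q2Q)
  × (- u ≤ - (Q * Q) * i - (Q * Q * Q - Q) * j - (Q * Q * Q + Q * Q - Q - + 1) * k)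
  where
    Q : ℤ
    Q = + q
    Q2Q : ℤ
    Q2Q = Q * Q + Q

HasCard : (ℤ × ℤ × ℤ → Set) → ℕ → Set
HasCard P n = Σ (List (ℤ × ℤ × ℤ)) λ xs →
  Unique xs × (∀ x → (x ∈ xs) ⇔ P x) × length xs ≡ n
  where open import Relation.Binary.PropositionalEquality using (_≡_)

-- In the coordinates L = qi + (q²+q)j + (q+1)k, m = i + qj + (q+1)k, w = i + (q+1)j + k,
-- obtained from (i, j, k) by a unimodular change of variables, the conditions defining Ω say:
-- L lies in the window −t ≤ L < −t + q² + q; m is one of the q consecutive integers starting at
-- m₀ = ⌊(L+q)/(q+1)⌋; w ≥ w₀ = ⌊L/q⌋; and m + qw ≤ ⌊(L + (L+q)(q²+q))/(q²+q)⌋. As m runs over a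
-- complete residue system modulo q, (m, w) ↦ m + qw maps the fibre over L bijectively onto an
-- integer interval, nonempty on the window. Summing its length over the window gives sums of
-- floors over full periods, evaluated by Hermite's identity Σ_{x=a}^{a+d−1} ⌊x/d⌋ = a; what
-- remains is a polynomial identity in q and t.

module Submission where

open import Defs
open import Data.Nat using (ℕ)
open import Data.Integer using (ℤ; +_; _+_; _-_; _*_; _≤_; _<_)
open import Data.Product using (Σ; _×_)
open import Relation.Binary.PropositionalEquality using (_≡_)

open import Data.Integer.Base
  using (-[1+_]; 0ℤ; 1ℤ; -1ℤ; -_; _/ℕ_; _%ℕ_; ∣_∣; +≤+; +<+; nonNegative)
  renaming (suc to sucℤ)
open import Data.Integer.DivMod using (a≡a%ℕn+[a/ℕn]*n; n%ℕd<d)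
open import Data.Integer.Properties
open import Algebra.Properties.AbelianGroup +-0-abelianGroup
  using () renaming (∙-cancelˡ to +-cancelˡ-≡; ∙-cancelʳ to +-cancelʳ-≡)
open import Data.Integer.Tactic.RingSolver using (solve; solve-∀)
open import Data.List using (List; []; _∷_; _++_; map; length)
open import Data.List.Membership.Propositional using (_∈_)
open import Data.List.Membership.Propositional.Properties
  using (∈-map⁺; ∈-map⁻; ∈-++⁺ˡ; ∈-++⁺ʳ; ∈-++⁻)
open import Data.List.Properties using (length-++; length-map)
import Data.List.Relation.Unary.All as All
open import Data.List.Relation.Unary.AllPairs using ([]; _∷_)
open import Data.List.Relation.Unary.Any using (here; there)
open import Data.List.Relation.Unary.Unique.Propositional using (Unique)
import Data.List.Relation.Unary.Unique.Propositional.Properties as Unique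
open import Data.Nat as ℕ using (zero; suc)
open import Data.Nat.Primality using (Prime; ¬prime[0])
import Data.Nat.Properties as ℕ
open import Data.Nat.Tactic.RingSolver using () renaming (solve-∀ to ℕ-solve-∀)
import Data.Product as Product
open import Data.Product using (_,_; proj₁; proj₂; ∃)
open import Data.Product.Properties using (×-≡,≡→≡)
open import Data.Sum using (inj₁; inj₂)
open import Function using (_∘_)
open import Function.Bundles using (mk⇔)
open import Relation.Binary.PropositionalEquality
  using (refl; sym; trans; cong; cong₂; subst; _≢_; module ≡-Reasoning)
open import Relation.Nullary using (¬_; yes; no)
open import Relation.Nullary.Negation using (contradiction)

≤-by-gap : ∀ a b c → 0ℤ ≤ c → b ≡ a + c → a ≤ b
≤-by-gap a _ c 0≤c refl = subst (_≤ a + c) (+-identityʳ a) (+-monoʳ-≤ a 0≤c)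

<-by-gap : ∀ a b c → 0ℤ ≤ c → b ≡ a + c + 1ℤ → a < b
<-by-gap a b c 0≤c b≡ = suc[i]≤j⇒i<j (≤-by-gap (sucℤ a) b c 0≤c (trans b≡ (shift a c)))
  where
  shift : ∀ a c → a + c + 1ℤ ≡ 1ℤ + a + c
  shift = solve-∀

i<j⇒0≤j-i-1 : ∀ {i j} → i < j → 0ℤ ≤ j - i - 1ℤ
i<j⇒0≤j-i-1 {i} {j} i<j = subst (0ℤ ≤_) (regroup i j) (i≤j⇒0≤j-i (i<j⇒suc[i]≤j i<j))
  where
  regroup : ∀ i j → j - (1ℤ + i) ≡ j - i - 1ℤ
  regroup = solve-∀

0≤i*j : ∀ {i j} → 0ℤ ≤ i → 0ℤ ≤ j → 0ℤ ≤ i * j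
0≤i*j {i} {j} 0≤i 0≤j = *-monoʳ-≤-nonNeg j {{nonNegative 0≤j}} 0≤i

i<suc[i] : ∀ i → i < sucℤ i
i<suc[i] i = suc[i]≤j⇒i<j ≤-refl

i<1+j⇒i≤j : ∀ {i j} → i < sucℤ j → i ≤ j
i<1+j⇒i≤j {i} {j} i<1+j = subst (i ≤_) (pred-suc j) (i<j⇒i≤pred[j] i<1+j)

ℤ-induction : (P : ℤ → Set) → P 0ℤ → (∀ i → P i → P (sucℤ i)) → (∀ i → P (sucℤ i) → P i) →
              ∀ i → P i
ℤ-induction P P0 up down (+ zero)     = P0
ℤ-induction P P0 up down (+ suc n)    = up (+ n) (ℤ-induction P P0 up down (+ n))
ℤ-induction P P0 up down -[1+ zero ]  = down -1ℤ P0
ℤ-induction P P0 up down -[1+ suc n ] = down -[1+ suc n ] (ℤ-induction P P0 up down -[1+ n ])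

range : ℤ → ℕ → List ℤ
range a zero    = []
range a (suc n) = a ∷ range (sucℤ a) n

private
  suc-+-shift : ∀ a n → sucℤ a + + n ≡ a + + suc n
  suc-+-shift a n = shift a (+ n)
    where
    shift : ∀ a b → 1ℤ + a + b ≡ a + (1ℤ + b)
    shift = solve-∀

∈-range⁻ : ∀ {a n x} → x ∈ range a n → a ≤ x × x < a + + n
∈-range⁻ {a} {suc n} (here refl) =
  ≤-refl , subst (a <_) (suc-+-shift a n) (<-≤-trans (i<suc[i] a) (i≤i+j (sucℤ a) (+ n)))
∈-range⁻ {a} {suc n} {x} (there x∈) with ∈-range⁻ x∈
... | 1+a≤x , x<1+a+n = ≤-trans (i≤suc[i] a) 1+a≤x , subst (x <_) (suc-+-shift a n) x<1+a+n

∈-range⁺ : ∀ {a n x} → a ≤ x → x < a + + n → x ∈ range a n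
∈-range⁺ {a} {zero}  a≤x x<a = contradiction (subst (_ <_) (+-identityʳ a) x<a) (≤⇒≯ a≤x)
∈-range⁺ {a} {suc n} {x} a≤x x<a+n with a ≟ x
... | yes refl = here refl
... | no a≢x   = there (∈-range⁺ (i<j⇒suc[i]≤j (≤∧≢⇒< a≤x a≢x))
                                 (subst (x <_) (sym (suc-+-shift a n)) x<a+n))

range-unique : ∀ a n → Unique (range a n)
range-unique a zero    = []
range-unique a (suc n) = All.tabulate a∉ ∷ range-unique (sucℤ a) n
  where
  a∉ : ∀ {x} → x ∈ range (sucℤ a) n → a ≢ x
  a∉ x∈ refl = <-irrefl refl (suc[i]≤j⇒i<j (proj₁ (∈-range⁻ x∈)))

length-range : ∀ a n → length (range a n) ≡ n
length-range a zero    = refl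
length-range a (suc n) = cong suc (length-range (sucℤ a) n)

∑ : ℤ → ℕ → (ℤ → ℤ) → ℤ
∑ a zero    f = 0ℤ
∑ a (suc n) f = f a + ∑ (sucℤ a) n f

∑-cong : ∀ a n {f g : ℤ → ℤ} → (∀ x → f x ≡ g x) → ∑ a n f ≡ ∑ a n g
∑-cong a zero    f≗g = refl
∑-cong a (suc n) f≗g = cong₂ _+_ (f≗g a) (∑-cong (sucℤ a) n f≗g)

∑-cong-∈ : ∀ a n {f g : ℤ → ℤ} → (∀ {x} → x ∈ range a n → f x ≡ g x) → ∑ a n f ≡ ∑ a n g
∑-cong-∈ a zero    f≗g = refl
∑-cong-∈ a (suc n) f≗g = cong₂ _+_ (f≗g (here refl)) (∑-cong-∈ (sucℤ a) n (f≗g ∘ there))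

∑-+ : ∀ a n (f g : ℤ → ℤ) → ∑ a n (λ x → f x + g x) ≡ ∑ a n f + ∑ a n g
∑-+ a zero    f g = refl
∑-+ a (suc n) f g = begin
  f a + g a + ∑ (sucℤ a) n (λ x → f x + g x)     ≡⟨ cong (_+_ (f a + g a)) (∑-+ (sucℤ a) n f g) ⟩
  f a + g a + (∑ (sucℤ a) n f + ∑ (sucℤ a) n g)  ≡⟨ interchange (f a) (g a) _ _ ⟩
  f a + ∑ (sucℤ a) n f + (g a + ∑ (sucℤ a) n g)  ∎
  where
  open ≡-Reasoning
  interchange : ∀ a b c d → a + b + (c + d) ≡ a + c + (b + d)
  interchange = solve-∀

∑-neg : ∀ a n (f : ℤ → ℤ) → ∑ a n (λ x → - f x) ≡ - ∑ a n f
∑-neg a zero    f = refl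
∑-neg a (suc n) f = begin
  - f a + ∑ (sucℤ a) n (λ x → - f x) ≡⟨ cong (_+_ (- f a)) (∑-neg (sucℤ a) n f) ⟩
  - f a + - ∑ (sucℤ a) n f           ≡⟨ neg-distrib-+ (f a) _ ⟨
  - (f a + ∑ (sucℤ a) n f)           ∎
  where open ≡-Reasoning

∑-− : ∀ a n (f g : ℤ → ℤ) → ∑ a n (λ x → f x - g x) ≡ ∑ a n f - ∑ a n g
∑-− a n f g = trans (∑-+ a n f (λ x → - g x)) (cong (_+_ (∑ a n f)) (∑-neg a n g))

∑-*ʳ : ∀ a n (f : ℤ → ℤ) c → ∑ a n (λ x → f x * c) ≡ ∑ a n f * c
∑-*ʳ a zero    f c = refl
∑-*ʳ a (suc n) f c = begin
  f a * c + ∑ (sucℤ a) n (λ x → f x * c) ≡⟨ cong (_+_ (f a * c)) (∑-*ʳ (sucℤ a) n f c) ⟩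
  f a * c + ∑ (sucℤ a) n f * c           ≡⟨ *-distribʳ-+ c (f a) _ ⟨
  (f a + ∑ (sucℤ a) n f) * c             ∎
  where open ≡-Reasoning

∑-const : ∀ a n c → ∑ a n (λ _ → c) ≡ + n * c
∑-const a zero    c = refl
∑-const a (suc n) c = begin
  c + ∑ (sucℤ a) n (λ _ → c) ≡⟨ cong (_+_ c) (∑-const (sucℤ a) n c) ⟩
  c + + n * c                ≡⟨ suc-* (+ n) c ⟨
  + suc n * c                ∎
  where open ≡-Reasoning

∑-shift : ∀ a n c (f : ℤ → ℤ) → ∑ a n (λ x → f (x + c)) ≡ ∑ (a + c) n f
∑-shift a zero    c f = refl
∑-shift a (suc n) c f = cong (_+_ (f (a + c))) (begin
  ∑ (sucℤ a) n (λ x → f (x + c)) ≡⟨ ∑-shift (sucℤ a) n c f ⟩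
  ∑ (sucℤ a + c) n f             ≡⟨ cong (λ b → ∑ b n f) (+-assoc 1ℤ a c) ⟩
  ∑ (sucℤ (a + c)) n f           ∎)
  where open ≡-Reasoning

∑-++ : ∀ a m n (f : ℤ → ℤ) → ∑ a (m ℕ.+ n) f ≡ ∑ a m f + ∑ (a + + m) n f
∑-++ a zero    n f = trans (cong (λ b → ∑ b n f) (sym (+-identityʳ a))) (sym (+-identityˡ _))
∑-++ a (suc m) n f = begin
  f a + ∑ (sucℤ a) (m ℕ.+ n) f                   ≡⟨ cong (_+_ (f a)) (∑-++ (sucℤ a) m n f) ⟩
  f a + (∑ (sucℤ a) m f + ∑ (sucℤ a + + m) n f)  ≡⟨ +-assoc (f a) _ _ ⟨
  f a + ∑ (sucℤ a) m f + ∑ (sucℤ a + + m) n f    ≡⟨ cong (λ b → f a + ∑ (sucℤ a) m f + ∑ b n f) (suc-+-shift a m) ⟩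
  f a + ∑ (sucℤ a) m f + ∑ (a + + suc m) n f     ∎
  where open ≡-Reasoning

∑-snoc : ∀ a n (f : ℤ → ℤ) → ∑ a (suc n) f ≡ ∑ a n f + f (a + + n)
∑-snoc a n f = begin
  ∑ a (suc n) f              ≡⟨ cong (λ k → ∑ a k f) (ℕ.+-comm 1 n) ⟩
  ∑ a (n ℕ.+ 1) f            ≡⟨ ∑-++ a n 1 f ⟩
  ∑ a n f + (f (a + + n) + 0ℤ) ≡⟨ cong (_+_ (∑ a n f)) (+-identityʳ _) ⟩
  ∑ a n f + f (a + + n)      ∎
  where open ≡-Reasoning

triangle : ℕ → ℤ
triangle zero    = 0ℤ
triangle (suc n) = + n + triangle n

2*triangle : ∀ n → + 2 * triangle n ≡ + n * (+ n - 1ℤ)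
2*triangle zero    = refl
2*triangle (suc n) = begin
  + 2 * (+ n + triangle n)         ≡⟨ *-distribˡ-+ (+ 2) (+ n) _ ⟩
  + 2 * + n + + 2 * triangle n     ≡⟨ cong (_+_ (+ 2 * + n)) (2*triangle n) ⟩
  + 2 * + n + + n * (+ n - 1ℤ)     ≡⟨ step (+ n) ⟩
  (1ℤ + + n) * (1ℤ + + n - 1ℤ)     ∎
  where
  open ≡-Reasoning
  step : ∀ m → + 2 * m + m * (m - 1ℤ) ≡ (1ℤ + m) * (1ℤ + m - 1ℤ)
  step = solve-∀

∑-id : ∀ a n → ∑ a n (λ x → x) ≡ + n * a + triangle n
∑-id a zero    = sym (*-zeroˡ a)
∑-id a (suc n) = begin
  a + ∑ (sucℤ a) n (λ x → x)          ≡⟨ cong (_+_ a) (∑-id (sucℤ a) n) ⟩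
  a + (+ n * (1ℤ + a) + triangle n)   ≡⟨ step a (+ n) (triangle n) ⟩
  (1ℤ + + n) * a + (+ n + triangle n) ∎
  where
  open ≡-Reasoning
  step : ∀ a m t → a + (m * (1ℤ + a) + t) ≡ (1ℤ + m) * a + (m + t)
  step = solve-∀

module FloorDiv (d : ℕ) .{{_ : ℕ.NonZero d}} where

  D : ℤ
  D = + d

  ⌊_⌋ : ℤ → ℤ
  ⌊ x ⌋ = x /ℕ d

  rem : ℤ → ℤ
  rem x = + (x %ℕ d)

  rem+⌊⌋*d : ∀ x → rem x + ⌊ x ⌋ * D ≡ x
  rem+⌊⌋*d x = sym (a≡a%ℕn+[a/ℕn]*n x d)

  rem<d : ∀ x → rem x < D
  rem<d x = +<+ (n%ℕd<d x d)

  y≤⌊x⌋⇒y*d≤x : ∀ {x y} → y ≤ ⌊ x ⌋ → y * D ≤ x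
  y≤⌊x⌋⇒y*d≤x {x} {y} y≤⌊x⌋ = begin
    y * D             ≤⟨ *-monoʳ-≤-nonNeg D y≤⌊x⌋ ⟩
    ⌊ x ⌋ * D         ≤⟨ i≤j+i _ (rem x) ⟩
    rem x + ⌊ x ⌋ * D ≡⟨ rem+⌊⌋*d x ⟩
    x                 ∎
    where open ≤-Reasoning

  ⌊x⌋≤y⇒x<[1+y]*d : ∀ {x y} → ⌊ x ⌋ ≤ y → x < sucℤ y * D
  ⌊x⌋≤y⇒x<[1+y]*d {x} {y} ⌊x⌋≤y = begin-strict
    x                 ≡⟨ rem+⌊⌋*d x ⟨
    rem x + ⌊ x ⌋ * D <⟨ +-monoˡ-< (⌊ x ⌋ * D) (rem<d x) ⟩
    D + ⌊ x ⌋ * D     ≡⟨ suc-* ⌊ x ⌋ D ⟨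
    sucℤ ⌊ x ⌋ * D    ≤⟨ *-monoʳ-≤-nonNeg D (suc-mono ⌊x⌋≤y) ⟩
    sucℤ y * D        ∎
    where open ≤-Reasoning

  y*d≤x⇒y≤⌊x⌋ : ∀ {x y} → y * D ≤ x → y ≤ ⌊ x ⌋
  y*d≤x⇒y≤⌊x⌋ {x} {y} y*d≤x = ≮⇒≥ λ ⌊x⌋<y →
    ≤⇒≯ (≤-trans (*-monoʳ-≤-nonNeg D (i<j⇒suc[i]≤j ⌊x⌋<y)) y*d≤x) (⌊x⌋≤y⇒x<[1+y]*d ≤-refl)

  x<[1+y]*d⇒⌊x⌋≤y : ∀ {x y} → x < sucℤ y * D → ⌊ x ⌋ ≤ y
  x<[1+y]*d⇒⌊x⌋≤y {x} {y} x<[1+y]*d = ≮⇒≥ λ y<⌊x⌋ →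
    ≤⇒≯ (y≤⌊x⌋⇒y*d≤x (i<j⇒suc[i]≤j y<⌊x⌋)) x<[1+y]*d

  divMod-unique : ∀ {r y} → 0ℤ ≤ r → r < D → rem (r + y * D) ≡ r × ⌊ r + y * D ⌋ ≡ y
  divMod-unique {r} {y} 0≤r r<d = rem≡ , ⌊⌋≡
    where
    ⌊⌋≡ : ⌊ r + y * D ⌋ ≡ y
    ⌊⌋≡ = ≤-antisym
      (x<[1+y]*d⇒⌊x⌋≤y (subst (r + y * D <_) (sym (suc-* y D)) (+-monoˡ-< (y * D) r<d)))
      (y*d≤x⇒y≤⌊x⌋ (≤-by-gap (y * D) _ r 0≤r (+-comm r (y * D))))
    rem≡ : rem (r + y * D) ≡ r
    rem≡ = +-cancelʳ-≡ (y * D) _ _ (trans (cong (λ z → rem (r + y * D) + z * D) (sym ⌊⌋≡))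
                                           (rem+⌊⌋*d (r + y * D)))

  ⌊x+y*d⌋≡⌊x⌋+y : ∀ x y → ⌊ x + y * D ⌋ ≡ ⌊ x ⌋ + y
  ⌊x+y*d⌋≡⌊x⌋+y x y = begin
    ⌊ x + y * D ⌋                    ≡⟨ cong (λ z → ⌊ z + y * D ⌋) (rem+⌊⌋*d x) ⟨
    ⌊ rem x + ⌊ x ⌋ * D + y * D ⌋    ≡⟨ cong ⌊_⌋ (+-assoc (rem x) (⌊ x ⌋ * D) (y * D)) ⟩
    ⌊ rem x + (⌊ x ⌋ * D + y * D) ⌋  ≡⟨ cong (λ z → ⌊ rem x + z ⌋) (*-distribʳ-+ D ⌊ x ⌋ y) ⟨
    ⌊ rem x + (⌊ x ⌋ + y) * D ⌋      ≡⟨ proj₂ (divMod-unique (+≤+ ℕ.z≤n) (rem<d x)) ⟩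
    ⌊ x ⌋ + y                        ∎
    where open ≡-Reasoning

  ⌊x⌋≡0 : ∀ {x} → 0ℤ ≤ x → x < D → ⌊ x ⌋ ≡ 0ℤ
  ⌊x⌋≡0 {x} 0≤x x<d = trans (cong ⌊_⌋ (sym (+-identityʳ x))) (proj₂ (divMod-unique 0≤x x<d))

  ∑-⌊⌋-period : ∀ a → ∑ a d ⌊_⌋ ≡ a
  ∑-⌊⌋-period = ℤ-induction (λ a → ∑ a d ⌊_⌋ ≡ a) base
    (λ a IH → trans (step a) (trans (cong (_+ 1ℤ) IH) (+-comm a 1ℤ)))
    (λ a IH → +-cancelʳ-≡ 1ℤ _ _ (trans (sym (step a)) (trans IH (+-comm 1ℤ a))))
    where
    open ≡-Reasoning
    base : ∑ 0ℤ d ⌊_⌋ ≡ 0ℤ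
    base = begin
      ∑ 0ℤ d ⌊_⌋       ≡⟨ ∑-cong-∈ 0ℤ d (λ x∈ → ⌊x⌋≡0 (proj₁ (∈-range⁻ x∈)) (proj₂ (∈-range⁻ x∈))) ⟩
      ∑ 0ℤ d (λ _ → 0ℤ) ≡⟨ ∑-const 0ℤ d 0ℤ ⟩
      D * 0ℤ           ≡⟨ *-zeroʳ D ⟩
      0ℤ               ∎
    step : ∀ a → ∑ (sucℤ a) d ⌊_⌋ ≡ ∑ a d ⌊_⌋ + 1ℤ
    step a = +-cancelˡ-≡ ⌊ a ⌋ _ _ (begin
      ∑ a (suc d) ⌊_⌋               ≡⟨ ∑-snoc a d ⌊_⌋ ⟩
      ∑ a d ⌊_⌋ + ⌊ a + D ⌋         ≡⟨ cong (λ z → ∑ a d ⌊_⌋ + ⌊ a + z ⌋) (*-identityˡ D) ⟨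
      ∑ a d ⌊_⌋ + ⌊ a + 1ℤ * D ⌋    ≡⟨ cong (_+_ (∑ a d ⌊_⌋)) (⌊x+y*d⌋≡⌊x⌋+y a 1ℤ) ⟩
      ∑ a d ⌊_⌋ + (⌊ a ⌋ + 1ℤ)      ≡⟨ swap (∑ a d ⌊_⌋) ⌊ a ⌋ ⟩
      ⌊ a ⌋ + (∑ a d ⌊_⌋ + 1ℤ)      ∎)
      where
      swap : ∀ s f → s + (f + 1ℤ) ≡ f + (s + 1ℤ)
      swap = solve-∀

  ∑-⌊⌋-periods : ∀ a n → ∑ a (n ℕ.* d) ⌊_⌋ ≡ + n * a + D * triangle n
  ∑-⌊⌋-periods a zero    = sym (trans (cong (_+_ (0ℤ * a)) (*-zeroʳ D)) (*-zeroˡ a))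
  ∑-⌊⌋-periods a (suc n) = begin
    ∑ a (d ℕ.+ n ℕ.* d) ⌊_⌋                      ≡⟨ ∑-++ a d (n ℕ.* d) ⌊_⌋ ⟩
    ∑ a d ⌊_⌋ + ∑ (a + D) (n ℕ.* d) ⌊_⌋          ≡⟨ cong₂ _+_ (∑-⌊⌋-period a) (∑-⌊⌋-periods (a + D) n) ⟩
    a + (+ n * (a + D) + D * triangle n)         ≡⟨ collect a D (+ n) (triangle n) ⟩
    (1ℤ + + n) * a + D * (+ n + triangle n)      ∎
    where
    open ≡-Reasoning
    collect : ∀ a D m t → a + (m * (a + D) + D * t) ≡ (1ℤ + m) * a + D * (m + t)
    collect = solve-∀

  low high : ℤ → ℤ → ℤ
  low a v = a + rem (v - a)
  high a v = ⌊ v - a ⌋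

  low+high*d : ∀ a v → low a v + high a v * D ≡ v
  low+high*d a v = begin
    a + rem (v - a) + ⌊ v - a ⌋ * D    ≡⟨ +-assoc a _ _ ⟩
    a + (rem (v - a) + ⌊ v - a ⌋ * D)  ≡⟨ cong (_+_ a) (rem+⌊⌋*d (v - a)) ⟩
    a + (v - a)                        ≡⟨ cancel a v ⟩
    v                                  ∎
    where
    open ≡-Reasoning
    cancel : ∀ a v → a + (v - a) ≡ v
    cancel = solve-∀

  a≤low : ∀ a v → a ≤ low a v
  a≤low a v = i≤i+j a (rem (v - a))

  low-d<a : ∀ a v → low a v - D < a
  low-d<a a v = <-by-gap _ a _ (i<j⇒0≤j-i-1 (rem<d (v - a))) (regroup a (rem (v - a)) D)
    where
    regroup : ∀ a r D → a ≡ a + r - D + (D - r - 1ℤ) + 1ℤ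
    regroup = solve-∀

  low-high-unique : ∀ {a m} w → a ≤ m → m - D < a → low a (m + w * D) ≡ m × high a (m + w * D) ≡ w
  low-high-unique {a} {m} w a≤m m-d<a = low≡ , high≡
    where
    regroup : ∀ m w D a → m + w * D - a ≡ (m - a) + w * D
    regroup = solve-∀
    m-a<d : m - a < D
    m-a<d = <-by-gap _ D _ (i<j⇒0≤j-i-1 m-d<a) (gap m a D)
      where
      gap : ∀ m a D → D ≡ m - a + (a - (m - D) - 1ℤ) + 1ℤ
      gap = solve-∀
    unique = divMod-unique {y = w} (i≤j⇒0≤j-i a≤m) m-a<d
    high≡ : high a (m + w * D) ≡ w
    high≡ = trans (cong ⌊_⌋ (regroup m w D a)) (proj₂ unique)
    low≡ : low a (m + w * D) ≡ m
    low≡ = trans (cong (λ z → a + rem z) (regroup m w D a))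
                 (trans (cong (_+_ a) (proj₁ unique)) (cancel a m))
      where
      cancel : ∀ a m → a + (m - a) ≡ m
      cancel = solve-∀

  high-greatest : ∀ {a v y} → a + y * D ≤ v → y ≤ high a v
  high-greatest {a} {v} {y} a+y*d≤v =
    y*d≤x⇒y≤⌊x⌋ (≤-by-gap (y * D) (v - a) _ (i≤j⇒0≤j-i a+y*d≤v) (regroup a v (y * D)))
    where
    regroup : ∀ a v e → v - a ≡ e + (v - (a + e))
    regroup = solve-∀

[_⋯_] : ℤ → ℤ → List ℤ
[ a ⋯ b ] = range a ∣ sucℤ b - a ∣

private
  +∣1+b-a∣≡1+b-a : ∀ {a b} → a ≤ b → + ∣ sucℤ b - a ∣ ≡ sucℤ b - a
  +∣1+b-a∣≡1+b-a {b = b} a≤b = 0≤i⇒+∣i∣≡i (i≤j⇒0≤j-i (≤-trans a≤b (i≤suc[i] b)))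

  a+∣1+b-a∣≡1+b : ∀ {a b} → a ≤ b → a + + ∣ sucℤ b - a ∣ ≡ sucℤ b
  a+∣1+b-a∣≡1+b {a} {b} a≤b = trans (cong (_+_ a) (+∣1+b-a∣≡1+b-a a≤b)) (cancel a (sucℤ b))
    where
    cancel : ∀ a c → a + (c - a) ≡ c
    cancel = solve-∀

∈-interval⁻ : ∀ {a b x} → a ≤ b → x ∈ [ a ⋯ b ] → a ≤ x × x ≤ b
∈-interval⁻ a≤b x∈ with ∈-range⁻ x∈
... | a≤x , x<a+size = a≤x , i<1+j⇒i≤j (subst (_ <_) (a+∣1+b-a∣≡1+b a≤b) x<a+size)

∈-interval⁺ : ∀ {a b x} → a ≤ x → x ≤ b → x ∈ [ a ⋯ b ]
∈-interval⁺ a≤x x≤b =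
  ∈-range⁺ a≤x (subst (_ <_) (sym (a+∣1+b-a∣≡1+b (≤-trans a≤x x≤b))) (suc[i]≤j⇒i<j (suc-mono x≤b)))

length-interval : ∀ {a b} → a ≤ b → + length [ a ⋯ b ] ≡ sucℤ b - a
length-interval {a} a≤b = trans (cong +_ (length-range a _)) (+∣1+b-a∣≡1+b-a a≤b)

module Layers (lo hi : ℤ → ℤ) where

  layers : List ℤ → List (ℤ × ℤ)
  layers []       = []
  layers (L ∷ Ls) = map (L ,_) [ lo L ⋯ hi L ] ++ layers Ls

  ∈-layers⁺ : ∀ {Ls L v} → L ∈ Ls → v ∈ [ lo L ⋯ hi L ] → (L , v) ∈ layers Ls
  ∈-layers⁺ {L ∷ Ls}  (here refl) v∈ = ∈-++⁺ˡ (∈-map⁺ (L ,_) v∈)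
  ∈-layers⁺ {L' ∷ Ls} (there L∈)  v∈ = ∈-++⁺ʳ _ (∈-layers⁺ L∈ v∈)

  ∈-layers⁻ : ∀ {Ls L v} → (L , v) ∈ layers Ls → L ∈ Ls × v ∈ [ lo L ⋯ hi L ]
  ∈-layers⁻ {L' ∷ Ls} Lv∈ with ∈-++⁻ (map (L' ,_) [ lo L' ⋯ hi L' ]) Lv∈
  ... | inj₂ Lv∈Ls = Product.map₁ there (∈-layers⁻ Lv∈Ls)
  ... | inj₁ Lv∈L' with ∈-map⁻ (L' ,_) Lv∈L'
  ...   | v , v∈ , refl = here refl , v∈

  layers-unique : ∀ {Ls} → Unique Ls → Unique (layers Ls)
  layers-unique {[]}     []         = []
  layers-unique {L ∷ Ls} (L∉ ∷ Ls!) =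
    Unique.++⁺ (Unique.map⁺ (cong proj₂) (range-unique _ _)) (layers-unique Ls!) disjoint
    where
    disjoint : ∀ {y} → ¬ (y ∈ map (L ,_) [ lo L ⋯ hi L ] × y ∈ layers Ls)
    disjoint (y∈L , y∈Ls) with ∈-map⁻ (L ,_) y∈L
    ... | v , _ , refl = All.lookup L∉ (proj₁ (∈-layers⁻ y∈Ls)) refl

  length-layers : ∀ a n → (∀ {L} → L ∈ range a n → lo L ≤ hi L) →
                  + length (layers (range a n)) ≡ ∑ a n (λ L → sucℤ (hi L) - lo L)
  length-layers a zero    nonempty = refl
  length-layers a (suc n) nonempty = begin
    + length (map (a ,_) [ lo a ⋯ hi a ] ++ layers (range (sucℤ a) n))
      ≡⟨ cong +_ (length-++ (map (a ,_) [ lo a ⋯ hi a ])) ⟩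
    + (length (map (a ,_) [ lo a ⋯ hi a ]) ℕ.+ length (layers (range (sucℤ a) n)))
      ≡⟨ pos-+ (length (map (a ,_) [ lo a ⋯ hi a ])) _ ⟩
    + length (map (a ,_) [ lo a ⋯ hi a ]) + + length (layers (range (sucℤ a) n))
      ≡⟨ cong₂ _+_ (trans (cong +_ (length-map (a ,_) [ lo a ⋯ hi a ])) (length-interval (nonempty (here refl))))
                   (length-layers (sucℤ a) n (nonempty ∘ there)) ⟩
    sucℤ (hi a) - lo a + ∑ (sucℤ a) n (λ L → sucℤ (hi L) - lo L) ∎
    where open ≡-Reasoning

HasCard-map : ∀ {A : Set} {P : ℤ × ℤ × ℤ → Set} (Φ : A → ℤ × ℤ × ℤ) (θ : ℤ × ℤ × ℤ → A) →
              (∀ y → θ (Φ y) ≡ y) → (ys : List A) → Unique ys →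
              (∀ {y} → y ∈ ys → P (Φ y)) → (∀ {x} → P x → ∃ λ y → y ∈ ys × Φ y ≡ x) →
              HasCard P (length ys)
HasCard-map {P = P} Φ θ θ∘Φ ys ys! sound complete =
  map Φ ys , Unique.map⁺ Φ-injective ys! , (λ x → mk⇔ (to x) from) , length-map Φ ys
  where
  Φ-injective : ∀ {y y'} → Φ y ≡ Φ y' → y ≡ y'
  Φ-injective {y} {y'} Φy≡Φy' = trans (sym (θ∘Φ y)) (trans (cong θ Φy≡Φy') (θ∘Φ y'))
  to : ∀ x → x ∈ map Φ ys → P x
  to x x∈ with ∈-map⁻ Φ x∈
  ... | y , y∈ , refl = sound y∈
  from : ∀ {x} → P x → x ∈ map Φ ys
  from Px with complete Px
  ... | y , y∈ , refl = ∈-map⁺ Φ y∈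

-- The prime power is an integer variable Q here, so that the ring solver treats it as an atom.
-- The solver does not unfold φ, ψ or projections, so its identities spell out the polynomials.
module Coordinates (Q : ℤ) (1≤Q : 1ℤ ≤ Q) where

  A N : ℤ
  A = Q + + 1
  N = Q * Q + Q

  -- Ω q (q³ − q) 0 t (q³ + q²) of the statement is Ωℤ (+ q) t by definition.
  Ωℤ : ℤ → ℤ × ℤ × ℤ → Set
  Ωℤ t (i , j , k) =
    (- (Q * Q * Q - Q) ≤ i)
    × (- + 0 ≤ i + N * k) × (i + N * k < - + 0 + N)
    × (- t ≤ Q * i + N * j + A * k) × (Q * i + N * j + A * k < - t + N)
    × (- (Q * Q * Q + Q * Q) ≤ - (Q * Q) * i - (Q * Q * Q - Q) * j - (Q * Q * Q + Q * Q - Q - + 1) * k)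

  ψ : ℤ × ℤ × ℤ → ℤ × ℤ × ℤ
  ψ (i , j , k) = Q * i + N * j + A * k , i + Q * j + A * k , i + A * j + k

  φ : ℤ × ℤ × ℤ → ℤ × ℤ × ℤ
  φ (L , m , w) = A * m - (N + 1ℤ) * L + N * Q * w , w - m + Q * L - Q * Q * w , L - Q * w

  φ∘ψ : ∀ x → φ (ψ x) ≡ x
  φ∘ψ (i , j , k) = ×-≡,≡→≡ (e₁ Q i j k , ×-≡,≡→≡ (e₂ Q i j k , e₃ Q i j k))
    where
    e₁ : ∀ Q i j k → let A = Q + + 1 ; N = Q * Q + Q in
         A * (i + Q * j + A * k) - (N + 1ℤ) * (Q * i + N * j + A * k) + N * Q * (i + A * j + k) ≡ i
    e₁ = solve-∀
    e₂ : ∀ Q i j k → let A = Q + + 1 ; N = Q * Q + Q in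
         i + A * j + k - (i + Q * j + A * k) + Q * (Q * i + N * j + A * k) - Q * Q * (i + A * j + k) ≡ j
    e₂ = solve-∀
    e₃ : ∀ Q i j k → let A = Q + + 1 ; N = Q * Q + Q in
         Q * i + N * j + A * k - Q * (i + A * j + k) ≡ k
    e₃ = solve-∀

  ψ∘φ : ∀ y → ψ (φ y) ≡ y
  ψ∘φ (L , m , w) = ×-≡,≡→≡ (e₁ Q L m w , ×-≡,≡→≡ (e₂ Q L m w , e₃ Q L m w))
    where
    e₁ : ∀ Q L m w → let A = Q + + 1 ; N = Q * Q + Q in
         Q * (A * m - (N + 1ℤ) * L + N * Q * w) + N * (w - m + Q * L - Q * Q * w) + A * (L - Q * w) ≡ L
    e₁ = solve-∀
    e₂ : ∀ Q L m w → let A = Q + + 1 ; N = Q * Q + Q in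
         A * m - (N + 1ℤ) * L + N * Q * w + Q * (w - m + Q * L - Q * Q * w) + A * (L - Q * w) ≡ m
    e₂ = solve-∀
    e₃ : ∀ Q L m w → let A = Q + + 1 ; N = Q * Q + Q in
         A * m - (N + 1ℤ) * L + N * Q * w + A * (w - m + Q * L - Q * Q * w) + (L - Q * w) ≡ w
    e₃ = solve-∀

  -- Ωℤ in the coordinates ψ, with the bounds shaped to match the characterisations of floors.
  R : ℤ → ℤ × ℤ × ℤ → Set
  R t (L , m , w) =
    (- t ≤ L) × (L < - t + N)
    × (L + Q < (1ℤ + m) * A) × ((1ℤ + (m - Q)) * A ≤ L + Q)
    × (L < (1ℤ + w) * Q)
    × ((m + w * Q) * N ≤ L + (L + Q) * N)

  0≤Q : 0ℤ ≤ Q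
  0≤Q = ≤-trans (+≤+ ℕ.z≤n) 1≤Q

  0≤N : 0ℤ ≤ N
  0≤N = +-mono-≤ (0≤i*j 0≤Q 0≤Q) 0≤Q

  R⇒Ωℤ : ∀ {t} y → R t y → Ωℤ t (φ y)
  R⇒Ωℤ {t} (L , m , w) (-t≤L , L<-t+N , m-low , m-high , w-low , v-high) =
      ≤-by-gap _ _ _ (+-mono-≤ g₁ (0≤i*j 0≤N g₃)) (e₁ Q L m w)
    , ≤-by-gap _ _ _ g₁ (e₂ Q L m w)
    , <-by-gap _ _ _ g₂ (e₃ Q L m w)
    , subst (- t ≤_) (e₄ Q L m w) -t≤L
    , subst (_< - t + N) (e₄ Q L m w) L<-t+N
    , ≤-by-gap _ _ _ g₄ (e₆ Q L m w)
    where
    g₁ = i<j⇒0≤j-i-1 m-low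
    g₂ = i≤j⇒0≤j-i m-high
    g₃ = i<j⇒0≤j-i-1 w-low
    g₄ = i≤j⇒0≤j-i v-high
    e₁ : ∀ Q L m w → let A = Q + + 1 ; N = Q * Q + Q in
         A * m - (N + 1ℤ) * L + N * Q * w
         ≡ - (Q * Q * Q - Q) + ((1ℤ + m) * A - (L + Q) - 1ℤ + N * ((1ℤ + w) * Q - L - 1ℤ))
    e₁ = solve-∀
    e₂ : ∀ Q L m w → let A = Q + + 1 ; N = Q * Q + Q in
         A * m - (N + 1ℤ) * L + N * Q * w + N * (L - Q * w) ≡ - + 0 + ((1ℤ + m) * A - (L + Q) - 1ℤ)
    e₂ = solve-∀
    e₃ : ∀ Q L m w → let A = Q + + 1 ; N = Q * Q + Q in
         - + 0 + N ≡ A * m - (N + 1ℤ) * L + N * Q * w + N * (L - Q * w) + (L + Q - (1ℤ + (m - Q)) * A) + 1ℤ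
    e₃ = solve-∀
    e₄ : ∀ Q L m w → let A = Q + + 1 ; N = Q * Q + Q in
         L ≡ Q * (A * m - (N + 1ℤ) * L + N * Q * w) + N * (w - m + Q * L - Q * Q * w) + (Q + + 1) * (L - Q * w)
    e₄ = solve-∀
    e₆ : ∀ Q L m w → let A = Q + + 1 ; N = Q * Q + Q in
         - (Q * Q) * (A * m - (N + 1ℤ) * L + N * Q * w) - (Q * Q * Q - Q) * (w - m + Q * L - Q * Q * w)
           - (Q * Q * Q + Q * Q - Q - + 1) * (L - Q * w)
         ≡ - (Q * Q * Q + Q * Q) + (L + (L + Q) * N - (m + w * Q) * N)
    e₆ = solve-∀

  Ωℤ⇒R : ∀ {t} x → Ωℤ t x → R t (ψ x)
  Ωℤ⇒R {t} (i , j , k) (low-i , low-ik , high-ik , -t≤L , L<-t+N , low-u) =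
      -t≤L , L<-t+N
    , <-by-gap _ _ _ (i≤j⇒0≤j-i low-ik) (e₁ Q i j k)
    , ≤-by-gap _ _ _ (i<j⇒0≤j-i-1 high-ik) (e₂ Q i j k)
    , <-by-gap _ _ _ (i<j⇒0≤j-i-1 k<Q) (e₃ Q i j k)
    , ≤-by-gap _ _ _ (i≤j⇒0≤j-i low-u) (e₄ Q i j k)
    where
    e₀ : ∀ Q i k → let N = Q * Q + Q in
         N * Q ≡ N * k + ((- + 0 + N) - (i + N * k) - 1ℤ + (i - - (Q * Q * Q - Q))) + 1ℤ
    e₀ = solve-∀
    k<Q : k < Q
    k<Q = *-cancelˡ-<-nonNeg N {{nonNegative 0≤N}}
            (<-by-gap _ _ _ (+-mono-≤ (i<j⇒0≤j-i-1 high-ik) (i≤j⇒0≤j-i low-i)) (e₀ Q i k))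
    e₁ : ∀ Q i j k → let A = Q + + 1 ; N = Q * Q + Q in
         (1ℤ + (i + Q * j + A * k)) * A ≡ Q * i + N * j + A * k + Q + (i + N * k - - + 0) + 1ℤ
    e₁ = solve-∀
    e₂ : ∀ Q i j k → let A = Q + + 1 ; N = Q * Q + Q in
         Q * i + N * j + A * k + Q ≡ (1ℤ + (i + Q * j + A * k - Q)) * A + ((- + 0 + N) - (i + N * k) - 1ℤ)
    e₂ = solve-∀
    e₃ : ∀ Q i j k → let A = Q + + 1 ; N = Q * Q + Q in
         (1ℤ + (i + A * j + k)) * Q ≡ Q * i + N * j + A * k + (Q - k - 1ℤ) + 1ℤ
    e₃ = solve-∀
    e₄ : ∀ Q i j k → let A = Q + + 1 ; N = Q * Q + Q ; L = Q * i + N * j + A * k in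
         L + (L + Q) * N
         ≡ ((i + Q * j + A * k) + (i + A * j + k) * Q) * N
           + (- (Q * Q) * i - (Q * Q * Q - Q) * j - (Q * Q * Q + Q * Q - Q - + 1) * k - - (Q * Q * Q + Q * Q))
    e₄ = solve-∀

  fibre-nonempty : ∀ {t L h a w} → 0ℤ ≤ t → L < - t + N → L + (L + Q) * N < (1ℤ + h) * N →
          a * A ≤ L + Q → w * Q ≤ L → a + w * Q ≤ h
  fibre-nonempty {t} {L} {h} {a} {w} 0≤t L<-t+N K<[1+h]*N a*A≤L+Q w*Q≤L =
    i<1+j⇒i≤j (*-cancelʳ-<-nonNeg N {{nonNegative 0≤N}} (≤-<-trans lo*N≤K K<[1+h]*N))
    where
    0≤Q-1 : 0ℤ ≤ Q - 1ℤ
    0≤Q-1 = i≤j⇒0≤j-i 1≤Q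
    gap = Q * (L + Q - a * A) + N * (L - w * Q) + (Q - 1ℤ) * ((- t + N - L - 1ℤ) + t) + (Q + (Q - 1ℤ))
    0≤gap : 0ℤ ≤ gap
    0≤gap = +-mono-≤ (+-mono-≤ (+-mono-≤ (0≤i*j 0≤Q (i≤j⇒0≤j-i a*A≤L+Q)) (0≤i*j 0≤N (i≤j⇒0≤j-i w*Q≤L)))
                         (0≤i*j 0≤Q-1 (+-mono-≤ (i<j⇒0≤j-i-1 L<-t+N) 0≤t)))
                  (+-mono-≤ 0≤Q 0≤Q-1)
    e : ∀ Q t L a w → let A = Q + + 1 ; N = Q * Q + Q in
        L + (L + Q) * N ≡ (a + w * Q) * N + (Q * (L + Q - a * A) + N * (L - w * Q)
                          + (Q - 1ℤ) * ((- t + N - L - 1ℤ) + t) + (Q + (Q - 1ℤ)))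
    e = solve-∀
    lo*N≤K : (a + w * Q) * N ≤ L + (L + Q) * N
    lo*N≤K = ≤-by-gap _ _ gap 0≤gap (e Q t L a w)

count-identity : ∀ Q t TN Tq TA → let A = Q + + 1 ; N = Q * Q + Q in
  + 2 * TN ≡ N * (N - 1ℤ) → + 2 * Tq ≡ Q * (Q - 1ℤ) → + 2 * TA ≡ A * (A - 1ℤ) →
  - t + (N * - t + TN) - (Q * (- t + Q) + A * Tq) - (A * - t + Q * TA) * Q + N * A
  ≡ + 1 - (Q * Q * Q - + 2 * Q + + 1) + (Q * Q * Q - Q) + (Q - + 1) * t + (Q * Q * Q + Q * Q)
count-identity Q t TN Tq TA 2TN 2Tq 2TA =
  let A = Q + + 1 ; N = Q * Q + Q ; X = + 2 * (- t + N * - t - Q * (- t + Q) - A * - t * Q + N * A) in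
  *-cancelˡ-≡ (+ 2) _ _ (begin
  + 2 * (- t + (N * - t + TN) - (Q * (- t + Q) + A * Tq) - (A * - t + Q * TA) * Q + N * A)
    ≡⟨ solve (Q ∷ t ∷ TN ∷ Tq ∷ TA ∷ []) ⟩
  X + + 2 * TN - A * (+ 2 * Tq) - Q * Q * (+ 2 * TA)
    ≡⟨ cong₂ (λ x y → X + x - A * y - Q * Q * (+ 2 * TA)) 2TN 2Tq ⟩
  X + N * (N - 1ℤ) - A * (Q * (Q - 1ℤ)) - Q * Q * (+ 2 * TA)
    ≡⟨ cong (λ z → X + N * (N - 1ℤ) - A * (Q * (Q - 1ℤ)) - Q * Q * z) 2TA ⟩
  X + N * (N - 1ℤ) - A * (Q * (Q - 1ℤ)) - Q * Q * (A * (A - 1ℤ))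
    ≡⟨ solve (Q ∷ t ∷ []) ⟩
  + 2 * (+ 1 - (Q * Q * Q - + 2 * Q + + 1) + (Q * Q * Q - Q) + (Q - + 1) * t + (Q * Q * Q + Q * Q)) ∎)
  where open ≡-Reasoning

module Counting (p : ℕ) (t : ℤ) (0≤t : 0ℤ ≤ t) where

  q : ℕ
  q = suc p

  Q : ℤ
  Q = + q

  open Coordinates Q (+≤+ (ℕ.s≤s ℕ.z≤n))

  Nₙ : ℕ
  Nₙ = q ℕ.* q ℕ.+ q

  module ⌊/A⌋ = FloorDiv (q ℕ.+ 1)
  module ⌊/Q⌋ = FloorDiv q
  module ⌊/N⌋ = FloorDiv Nₙ

  m₀ w₀ hi lo : ℤ → ℤ
  m₀ L = ⌊/A⌋.⌊ L + Q ⌋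
  w₀ L = ⌊/Q⌋.⌊ L ⌋
  hi L = ⌊/N⌋.⌊ L + (L + Q) * N ⌋
  lo L = m₀ L + w₀ L * Q

  Window : ℤ → Set
  Window L = - t ≤ L × L < - t + N

  Fibre : ℤ → ℤ → ℤ → Set
  Fibre L m w = m₀ L ≤ m × m - Q < m₀ L × w₀ L ≤ w × m + w * Q ≤ hi L

  R⇒Window×Fibre : ∀ {L m w} → R t (L , m , w) → Window L × Fibre L m w
  R⇒Window×Fibre (-t≤L , L<-t+N , m-low , m-high , w-low , v-high) =
      (-t≤L , L<-t+N)
    , ⌊/A⌋.x<[1+y]*d⇒⌊x⌋≤y m-low
    , suc[i]≤j⇒i<j (⌊/A⌋.y*d≤x⇒y≤⌊x⌋ m-high)
    , ⌊/Q⌋.x<[1+y]*d⇒⌊x⌋≤y w-low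
    , ⌊/N⌋.y*d≤x⇒y≤⌊x⌋ v-high

  Window×Fibre⇒R : ∀ {L m w} → Window L → Fibre L m w → R t (L , m , w)
  Window×Fibre⇒R (-t≤L , L<-t+N) (m₀≤m , m-Q<m₀ , w₀≤w , v≤hi) =
      -t≤L , L<-t+N
    , ⌊/A⌋.⌊x⌋≤y⇒x<[1+y]*d m₀≤m
    , ⌊/A⌋.y≤⌊x⌋⇒y*d≤x (i<j⇒suc[i]≤j m-Q<m₀)
    , ⌊/Q⌋.⌊x⌋≤y⇒x<[1+y]*d w₀≤w
    , ⌊/N⌋.y≤⌊x⌋⇒y*d≤x v≤hi

  lo≤hi : ∀ {L} → Window L → lo L ≤ hi L
  lo≤hi {L} (_ , L<-t+N) = fibre-nonempty {h = hi L} {m₀ L} {w₀ L} 0≤t L<-t+N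
    (⌊/N⌋.⌊x⌋≤y⇒x<[1+y]*d ≤-refl) (⌊/A⌋.y≤⌊x⌋⇒y*d≤x ≤-refl) (⌊/Q⌋.y≤⌊x⌋⇒y*d≤x ≤-refl)

  Fibre⇒lo≤v≤hi : ∀ {L m w} → Fibre L m w → lo L ≤ m + w * Q × m + w * Q ≤ hi L
  Fibre⇒lo≤v≤hi (m₀≤m , _ , w₀≤w , v≤hi) = +-mono-≤ m₀≤m (*-monoʳ-≤-nonNeg Q w₀≤w) , v≤hi

  digits : ℤ → ℤ → ℤ × ℤ
  digits L v = ⌊/Q⌋.low (m₀ L) v , ⌊/Q⌋.high (m₀ L) v

  lo≤v≤hi⇒Fibre : ∀ {L v} → lo L ≤ v → v ≤ hi L → Fibre L (proj₁ (digits L v)) (proj₂ (digits L v))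
  lo≤v≤hi⇒Fibre {L} {v} lo≤v v≤hi =
      ⌊/Q⌋.a≤low (m₀ L) v
    , ⌊/Q⌋.low-d<a (m₀ L) v
    , ⌊/Q⌋.high-greatest lo≤v
    , subst (_≤ hi L) (sym (⌊/Q⌋.low+high*d (m₀ L) v)) v≤hi

  Φ : ℤ × ℤ → ℤ × ℤ × ℤ
  Φ (L , v) = φ (L , digits L v)

  undigits : ℤ × ℤ × ℤ → ℤ × ℤ
  undigits (L , m , w) = L , m + w * Q

  θ : ℤ × ℤ × ℤ → ℤ × ℤ
  θ = undigits ∘ ψ

  θ∘Φ : ∀ y → θ (Φ y) ≡ y
  θ∘Φ (L , v) = begin
    undigits (ψ (φ (L , digits L v)))               ≡⟨ cong undigits (ψ∘φ (L , digits L v)) ⟩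
    L , ⌊/Q⌋.low (m₀ L) v + ⌊/Q⌋.high (m₀ L) v * Q ≡⟨ cong (L ,_) (⌊/Q⌋.low+high*d (m₀ L) v) ⟩
    L , v                                           ∎
    where open ≡-Reasoning

  open Layers lo hi

  points : List (ℤ × ℤ)
  points = layers (range (- t) Nₙ)

  Window⇒∈range : ∀ {L} → Window L → L ∈ range (- t) Nₙ
  Window⇒∈range (-t≤L , L<-t+N) = ∈-range⁺ -t≤L L<-t+N

  points-sound : ∀ {y} → y ∈ points → Ωℤ t (Φ y)
  points-sound {L , v} y∈ =
    let L∈ , v∈ = ∈-layers⁻ y∈
        window = ∈-range⁻ L∈
        lo≤v , v≤hi = ∈-interval⁻ (lo≤hi {L} window) v∈
    in R⇒Ωℤ (L , digits L v) (Window×Fibre⇒R {L} window (lo≤v≤hi⇒Fibre {L} lo≤v v≤hi))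

  R⇒∈points : ∀ y → R t y → ∃ λ z → z ∈ points × Φ z ≡ φ y
  R⇒∈points (L , m , w) r with R⇒Window×Fibre {L} {m} {w} r
  ... | window , fibre@(m₀≤m , m-Q<m₀ , _) with Fibre⇒lo≤v≤hi {L} {m} {w} fibre
  ... | lo≤v , v≤hi =
      (L , m + w * Q)
    , ∈-layers⁺ (Window⇒∈range window) (∈-interval⁺ lo≤v v≤hi)
    , cong₂ (λ m' w' → φ (L , m' , w')) (proj₁ digits≡) (proj₂ digits≡)
    where
    digits≡ = ⌊/Q⌋.low-high-unique w m₀≤m m-Q<m₀

  points-complete : ∀ {x} → Ωℤ t x → ∃ λ y → y ∈ points × Φ y ≡ x
  points-complete {x} ω =
    let y , y∈ , Φy≡φψx = R⇒∈points (ψ x) (Ωℤ⇒R x ω) in y , y∈ , trans Φy≡φψx (φ∘ψ x)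

  size : ℤ → ℤ
  size L = sucℤ (hi L) - lo L

  size≡floors : ∀ L → size L ≡ ⌊/N⌋.⌊ L ⌋ + L - m₀ L - w₀ L * Q + A
  size≡floors L = begin
    1ℤ + hi L - (m₀ L + w₀ L * Q)
      ≡⟨ cong (λ h → 1ℤ + h - lo L) (⌊/N⌋.⌊x+y*d⌋≡⌊x⌋+y L (L + Q)) ⟩
    1ℤ + (⌊/N⌋.⌊ L ⌋ + (L + Q)) - (m₀ L + w₀ L * Q)
      ≡⟨ regroup ⌊/N⌋.⌊ L ⌋ L (m₀ L) (w₀ L) Q ⟩
    ⌊/N⌋.⌊ L ⌋ + L - m₀ L - w₀ L * Q + (Q + + 1) ∎
    where
    open ≡-Reasoning
    regroup : ∀ f L m w Q → 1ℤ + (f + (L + Q)) - (m + w * Q) ≡ f + L - m - w * Q + (Q + + 1)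
    regroup = solve-∀

  ∑-m₀ : ∀ a → ∑ a Nₙ m₀ ≡ Q * (a + Q) + A * triangle q
  ∑-m₀ a = begin
    ∑ a Nₙ m₀                            ≡⟨ ∑-shift a Nₙ Q ⌊/A⌋.⌊_⌋ ⟩
    ∑ (a + Q) Nₙ ⌊/A⌋.⌊_⌋                ≡⟨ cong (λ n → ∑ (a + Q) n ⌊/A⌋.⌊_⌋) (Nₙ≡ q) ⟩
    ∑ (a + Q) (q ℕ.* (q ℕ.+ 1)) ⌊/A⌋.⌊_⌋ ≡⟨ ⌊/A⌋.∑-⌊⌋-periods (a + Q) q ⟩
    Q * (a + Q) + A * triangle q         ∎
    where
    open ≡-Reasoning
    Nₙ≡ : ∀ q → q ℕ.* q ℕ.+ q ≡ q ℕ.* (q ℕ.+ 1)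
    Nₙ≡ = ℕ-solve-∀

  ∑-w₀ : ∀ a → ∑ a Nₙ w₀ ≡ A * a + Q * triangle (q ℕ.+ 1)
  ∑-w₀ a = trans (cong (λ n → ∑ a n ⌊/Q⌋.⌊_⌋) (Nₙ≡ q)) (⌊/Q⌋.∑-⌊⌋-periods a (q ℕ.+ 1))
    where
    Nₙ≡ : ∀ q → q ℕ.* q ℕ.+ q ≡ (q ℕ.+ 1) ℕ.* q
    Nₙ≡ = ℕ-solve-∀

  ∑-size : ∑ (- t) Nₙ size ≡ + 1 - (Q * Q * Q - + 2 * Q + + 1) + (Q * Q * Q - Q) + (Q - + 1) * t + (Q * Q * Q + Q * Q)
  ∑-size = begin
    ∑ a Nₙ size
      ≡⟨ ∑-cong a Nₙ size≡floors ⟩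
    ∑ a Nₙ (λ L → ⌊/N⌋.⌊ L ⌋ + L - m₀ L - w₀ L * Q + A)
      ≡⟨ ∑-+ a Nₙ (λ L → ⌊/N⌋.⌊ L ⌋ + L - m₀ L - w₀ L * Q) (λ _ → A) ⟩
    ∑ a Nₙ (λ L → ⌊/N⌋.⌊ L ⌋ + L - m₀ L - w₀ L * Q) + ∑ a Nₙ (λ _ → A)
      ≡⟨ cong₂ _+_ (∑-− a Nₙ (λ L → ⌊/N⌋.⌊ L ⌋ + L - m₀ L) (λ L → w₀ L * Q)) (∑-const a Nₙ A) ⟩
    ∑ a Nₙ (λ L → ⌊/N⌋.⌊ L ⌋ + L - m₀ L) - ∑ a Nₙ (λ L → w₀ L * Q) + N * A
      ≡⟨ cong₂ (λ x y → x - y + N * A) (∑-− a Nₙ (λ L → ⌊/N⌋.⌊ L ⌋ + L) m₀) (∑-*ʳ a Nₙ w₀ Q) ⟩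
    ∑ a Nₙ (λ L → ⌊/N⌋.⌊ L ⌋ + L) - ∑ a Nₙ m₀ - ∑ a Nₙ w₀ * Q + N * A
      ≡⟨ cong (λ x → x - ∑ a Nₙ m₀ - ∑ a Nₙ w₀ * Q + N * A) (∑-+ a Nₙ ⌊/N⌋.⌊_⌋ (λ L → L)) ⟩
    ∑ a Nₙ ⌊/N⌋.⌊_⌋ + ∑ a Nₙ (λ L → L) - ∑ a Nₙ m₀ - ∑ a Nₙ w₀ * Q + N * A
      ≡⟨ cong₂ (λ x y → x + y - ∑ a Nₙ m₀ - ∑ a Nₙ w₀ * Q + N * A) (⌊/N⌋.∑-⌊⌋-period a) (∑-id a Nₙ) ⟩
    a + (N * a + triangle Nₙ) - ∑ a Nₙ m₀ - ∑ a Nₙ w₀ * Q + N * A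
      ≡⟨ cong₂ (λ x y → a + (N * a + triangle Nₙ) - x - y * Q + N * A) (∑-m₀ a) (∑-w₀ a) ⟩
    a + (N * a + triangle Nₙ) - (Q * (a + Q) + A * triangle q) - (A * a + Q * triangle (q ℕ.+ 1)) * Q + N * A
      ≡⟨ count-identity Q t _ _ _ (2*triangle Nₙ) (2*triangle q) (2*triangle (q ℕ.+ 1)) ⟩
    + 1 - (Q * Q * Q - + 2 * Q + + 1) + (Q * Q * Q - Q) + (Q - + 1) * t + (Q * Q * Q + Q * Q) ∎
    where
    open ≡-Reasoning
    a = - t

  #Ω : Σ ℕ λ n → HasCard (Ωℤ t) n
              × + n ≡ + 1 - (Q * Q * Q - + 2 * Q + + 1) + (Q * Q * Q - Q) + (Q - + 1) * t + (Q * Q * Q + Q * Q)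
  #Ω = length points
        , HasCard-map Φ θ θ∘Φ points (layers-unique (range-unique (- t) Nₙ)) points-sound points-complete
        , trans (length-layers (- t) Nₙ (lo≤hi ∘ ∈-range⁻)) ∑-size

¬IsPrimePower[0] : ¬ IsPrimePower 0
¬IsPrimePower[0] (p , k , p-prime , 0≡p^[1+k]) =
  ¬prime[0] (subst Prime (ℕ.m^n≡0⇒m≡0 p (suc k) (sym 0≡p^[1+k])) p-prime)

lemma2p12 : (q : ℕ) → IsPrimePower q → (t : ℤ) → + 0 ≤ t → t < + q + + 1 →
    Σ ℕ λ n → HasCard (Ω q (+ q * + q * + q - + q) (+ 0) t (+ q * + q * + q + + q * + q)) n
      × + n ≡ + 1 - (+ q * + q * + q - + 2 * + q + + 1) + (+ q * + q * + q - + q) + (+ q - + 1) * t + (+ q * + q * + q + + q * + q)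
lemma2p12 zero    q-prime-power _ _   _ = contradiction q-prime-power ¬IsPrimePower[0]
lemma2p12 (suc p) _             t 0≤t _ = Counting.#Ω p t 0≤t
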